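{- Let $d$ be a positive square-free integer and $p$ an odd prime. Suppose that $a_1,a_3,v,s\in\mathbb{Z}$ satisfy $s\ge1$, $p\nmid a_1a_3v$, $v\mid d-1$, $a_1^2-da_3^2=d-1$ and $a_1-da_3=\frac{d-1}{v}p^s$, and that $[\overline{a_1,\frac{v}{p^s},a_3}]$ is a $p$-adically convergent expansion of $\sqrt d$ of type $(0,3)$. Let $k$ be the greatest common divisor of $a_1+a_3$ and $1-a_1a_3$. Then $$p^s\le k\,\frac{(d+1)^{3/2}+2d}{|d+1|_p^2}.$$
   Context: $|\cdot|_p$ is the $p$-adic absolute value and $\mathcal{O}=\mathbb{Z}[1/p]$. For a sequence $c_1,c_2,\dots$ put $A_0=1$, $A_1=c_1$, $A_n=c_nA_{n-1}+A_{n-2}$, $B_0=0$, $B_1=1$, $B_n=c_nB_{n-1}+B_{n-2}$; the $n$-th convergent is $[A_n:B_n]\in\mathbb{P}^1(\mathbb{Q})$ and $[c_1,c_2,\dots]$ converges $p$-adically if the convergents converge in $\mathbb{P}^1(\mathbb{Q}_p)$. $[\overline{a_1,a_2,a_3}]=[a_1,a_2,a_3,a_1,a_2,a_3,\dots]$. A $p$-adically convergent expansion of $\sqrt d$ of type $(0,3)$ is a triple $(a_1,a_2,a_3)\in\mathcal{O}^3$ satisfying $a_2-a_1-a_3-a_1a_2a_3=0$ and $d(a_2a_3+1)=a_1a_2+1$ (equivalently, the matrix $E=\prod_{i=1}^3\begin{pmatrix}a_i&1\\1&0\end{pmatrix}$ satisfies that $E_{21}x^2+(E_{22}-E_{11})x-E_{12}$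 is proportional to $x^2-d$) and such that $[\overline{a_1,a_2,a_3}]$ converges $p$-adically. -}

module Defs where

open import Data.Nat as ℕ using (ℕ; zero; suc)
open import Data.Nat.Divisibility as ℕD using (_∣?_; quotient)
open import Data.Integer as ℤ using (ℤ; +_)
open import Data.Rational as ℚ using (ℚ; 0ℚ; 1ℚ; ↥_; ↧ₙ_)
open import Data.Rational.Properties using () renaming (_≟_ to _≟ℚ_)
open import Data.Product using (Σ; _×_; ∃)
open import Data.Sum using (_⊎_)
open import Relation.Nullary using (yes; no)
open import Relation.Binary.PropositionalEquality using (_≡_)
open import Data.Nat.Properties using (m^n≢0)

SquareFree : ℕ → Set
SquareFree d = ∀ m → (m ℕ.* m) ℕD.∣ d → m ≡ 1

-- fuel-bounded valuation of a natural number; with fuel ≥ n and p ≥ 2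
-- this is the exact exponent of p in n (n ≥ 1); value at n = 0 is 0.
vℕ-aux : ℕ → ℕ → ℕ → ℕ
vℕ-aux p zero    n = 0
vℕ-aux p (suc f) zero = 0
vℕ-aux p (suc f) (suc n) with p ∣? suc n
... | yes p∣n = suc (vℕ-aux p f (quotient p∣n))
... | no  _   = 0

vℕ : ℕ → ℕ → ℕ
vℕ p n = vℕ-aux p n n

-- v_p(x) for a nonzero rational x (value at 0 is 0; never used there)
vℚ : ℕ → ℚ → ℤ
vℚ p x = (+ vℕ p ℤ.∣ ↥ x ∣) ℤ.- (+ vℕ p (↧ₙ x))

-- v_p of max(|a|_p , |b|_p), i.e. minimum of valuations of the nonzero
-- coordinates (for a point [a : b] of P¹ with (a , b) ≠ (0 , 0))
vmax : ℕ → ℚ → ℚ → ℤ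
vmax p a b with a ≟ℚ 0ℚ | b ≟ℚ 0ℚ
... | yes _ | _     = vℚ p b
... | no _  | yes _ = vℚ p a
... | no _  | no _  = vℚ p a ℤ.⊓ vℚ p b

-- The p-adic chordal distance on P¹(ℚ_p) between [a : b] and [c : e],
--   δ = |ae - bc|_p / (max(|a|_p,|b|_p) · max(|c|_p,|e|_p)),
-- is at most p^(-N).
ChordalWithin : ℕ → ℕ → ℚ → ℚ → ℚ → ℚ → Set
ChordalWithin p N a b c e =
  let w = (a ℚ.* e) ℚ.- (b ℚ.* c) in
  (w ≡ 0ℚ) ⊎ (((+ N) ℤ.+ vmax p a b ℤ.+ vmax p c e) ℤ.≤ vℚ p w)

-- A c n and B c n, for a sequence c indexed from 1 (c 0 is ignored)
A : (ℕ → ℚ) → ℕ → ℚ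
A c zero = 1ℚ
A c (suc zero) = c 1
A c (suc (suc n)) = (c (suc (suc n)) ℚ.* A c (suc n)) ℚ.+ A c n

B : (ℕ → ℚ) → ℕ → ℚ
B c zero = 0ℚ
B c (suc zero) = 1ℚ
B c (suc (suc n)) = (c (suc (suc n)) ℚ.* B c (suc n)) ℚ.+ B c n

-- [c₁, c₂, …] converges p-adically: the convergents [A n : B n] converge
-- in P¹(ℚ_p); stated as the Cauchy property for the chordal metric
-- (P¹(ℚ_p) is complete).
ConvergesPAdically : ℕ → (ℕ → ℚ) → Set
ConvergesPAdically p c =
  ∀ (N : ℕ) → ∃ λ (M : ℕ) → ∀ m n → M ℕ.≤ m → M ℕ.≤ n →
    ChordalWithin p N (A c m) (B c m) (A c n) (B c n)

per3 : ℚ → ℚ → ℚ → ℕ → ℚ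
per3 x y z zero = x
per3 x y z (suc zero) = x
per3 x y z (suc (suc zero)) = y
per3 x y z (suc (suc (suc zero))) = z
per3 x y z (suc (suc (suc (suc n)))) = per3 x y z (suc n)

ℤtoℚ : ℤ → ℚ
ℤtoℚ z = z ℚ./ 1

ℕtoℚ : ℕ → ℚ
ℕtoℚ n = ℤtoℚ (+ n)

-- v / p^s as a rational (p ≥ 1; the p = 0 case is never used)
divPow : ℤ → ℕ → ℕ → ℚ
divPow v zero s = 0ℚ
divPow v (suc q) s = v ℚ./ (suc q ℕ.^ s)
  where instance _ = m^n≢0 (suc q) s

In𝒪 : ℕ → ℚ → Set
In𝒪 p x = Σ ℕ λ n → Σ ℤ λ z → x ℚ.* ℕtoℚ (p ℕ.^ n) ≡ ℤtoℚ z

IsExpansion03 : ℕ → ℕ → ℚ → ℚ → ℚ → Set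
IsExpansion03 p d a₁ a₂ a₃ =
  In𝒪 p a₁ × In𝒪 p a₂ × In𝒪 p a₃ ×
  (((a₂ ℚ.- a₁) ℚ.- a₃) ℚ.- (a₁ ℚ.* a₂ ℚ.* a₃) ≡ 0ℚ) ×
  (ℕtoℚ d ℚ.* (a₂ ℚ.* a₃ ℚ.+ 1ℚ) ≡ a₁ ℚ.* a₂ ℚ.+ 1ℚ) ×
  ConvergesPAdically p (per3 a₁ a₂ a₃)

-- Real-free comparison:  x ≤ a + b·√c  for naturals x a b c
-- (equivalently x ≤ a, or (x - a)² ≤ b² c)
infix 4 _≤_+_√_
_≤_+_√_ : ℕ → ℕ → ℕ → ℕ → Set
x ≤ a + b √ c = (x ℕ.≤ a) ⊎ ((x ℕ.∸ a) ℕ.* (x ℕ.∸ a) ℕ.≤ (b ℕ.* b) ℕ.* c)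

{-# OPTIONS --safe #-}
module Submission where

-- Write q = p^s, u = a₁ + a₃ and t = 1 - a₁a₃, so that k = gcd(|u|, |t|). Clearing
-- denominators in a₂ - a₁ - a₃ - a₁a₂a₃ = 0 with a₂ = v/q gives v t = q u. Hence |u|
-- divides |v| k and |t| divides q k, and q divides t because p ∤ v.
--
-- For d = 1 the hypothesis v (a₁ - d a₃) = (d - 1) q forces a₁ = a₃ = x, so
-- t = -(x - 1)(x + 1). As p is odd, q divides one of the two factors, and t ∣ q k bounds
-- the other one by k; the factors differ by 2, so q ≤ k + 2 ≤ 3k.
--
-- For d ≥ 2 put e = a₁ - d a₃ and w = a₁ + d a₃. The Pell equation a₁² - d a₃² = d - 1
-- gives u e = (d - 1) t and w² + (d - 1)² = d u², and (d - 1) e = 2d u - (d + 1) w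
-- holds identically. Together with |v| ≤ d - 1 this yields
-- q |u| ≤ k (d - 1) |e| ≤ k (2d |u| + (d + 1) |w|), and |w| ≤ √(d + 1) |u|.
--
-- Both cases give the bound with k in place of K, so the p-adic factor, the
-- square-freeness of d, s ≥ 1 and the convergence of the expansion are not needed.

open import Defs
open import Data.Nat as ℕ using (ℕ; _≥_)
open import Data.Nat.Primality using (Prime)
open import Data.Integer as ℤ using (ℤ; +_)
open import Data.Integer.Divisibility using () renaming (_∣_ to _∣ℤ_)
open import Data.Integer.GCD using () renaming (gcd to gcdℤ)
open import Relation.Nullary using (¬_)
open import Relation.Binary.PropositionalEquality using (_≡_; _≢_)
open import Data.Nat using (zero; suc)
open import Data.Nat.Properties using (m≤m*n; m^n≢0)
open import Data.Nat.Divisibility using (_∣_; _∣0)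
open import Data.Nat.Primality using (prime⇒nonZero)
open import Data.Product using (_,_)
open import Relation.Binary.PropositionalEquality using (sym; subst)

module IntegersInRationals where

  open import Data.Nat using (suc; NonZero; _^_)
  open import Data.Nat.Properties using (*-identityʳ; m^n≢0)
  import Data.Nat.Coprimality as Coprimality
  open import Data.Integer using (_+_; _*_; _-_; 1ℤ)
  import Data.Integer.Properties as ℤ
  open import Data.Integer.Tactic.RingSolver using (solve)
  open import Data.Rational as ℚ using (mkℚ; 0ℚ; toℚᵘ)
  import Data.Rational.Properties as ℚ
  import Data.Rational.Unnormalised as ℚᵘ
  import Data.Rational.Unnormalised.Properties as ℚᵘ
  open import Data.List using ([]; _∷_)
  open import Level using (0ℓ)
  open import Relation.Nullary.Decidable using (dec⇒maybe)
  open import Relation.Binary.PropositionalEquality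
  open import Tactic.RingSolver using (solve-∀)
  open import Tactic.RingSolver.Core.AlmostCommutativeRing
    using (AlmostCommutativeRing; fromCommutativeRing)

  ℤtoℚ≡mkℚ : ∀ i → ℤtoℚ i ≡ mkℚ i 0 (Coprimality.sym (Coprimality.1-coprimeTo ℤ.∣ i ∣))
  ℤtoℚ≡mkℚ i = ℚ.↥p/↧p≡p (mkℚ i 0 _)

  ℤtoℚ-injective : ∀ {i j} → ℤtoℚ i ≡ ℤtoℚ j → i ≡ j
  ℤtoℚ-injective {i} {j} eq =
    cong ℚ.↥_ (trans (sym (ℤtoℚ≡mkℚ i)) (trans eq (ℤtoℚ≡mkℚ j)))

  ℤtoℚ-homo-+ : ∀ i j → ℤtoℚ (i + j) ≡ ℤtoℚ i ℚ.+ ℤtoℚ j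
  ℤtoℚ-homo-+ i j = trans
    (cong ℤtoℚ (cong₂ _+_ (sym (ℤ.*-identityʳ i)) (sym (ℤ.*-identityʳ j))))
    (sym (cong₂ ℚ._+_ (ℤtoℚ≡mkℚ i) (ℤtoℚ≡mkℚ j)))

  ℤtoℚ-homo-* : ∀ i j → ℤtoℚ (i * j) ≡ ℤtoℚ i ℚ.* ℤtoℚ j
  ℤtoℚ-homo-* i j = sym (cong₂ ℚ._*_ (ℤtoℚ≡mkℚ i) (ℤtoℚ≡mkℚ j))

  /-*-cancel : ∀ i n .{{_ : NonZero n}} → (i ℚ./ n) ℚ.* ℕtoℚ n ≡ ℤtoℚ i
  /-*-cancel i n@(suc m) = ℚ.toℚᵘ-injective (begin
    toℚᵘ (i ℚ./ n ℚ.* ℕtoℚ n)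
      ≈⟨ ℚ.toℚᵘ-homo-* (i ℚ./ n) (ℕtoℚ n) ⟩
    toℚᵘ (i ℚ./ n) ℚᵘ.* toℚᵘ (ℕtoℚ n)
      ≈⟨ ℚᵘ.*-cong (ℚ.toℚᵘ-fromℚᵘ (ℚᵘ.mkℚᵘ i m)) (ℚ.toℚᵘ-fromℚᵘ (ℚᵘ.mkℚᵘ (+ n) 0)) ⟩
    ℚᵘ.mkℚᵘ i m ℚᵘ.* ℚᵘ.mkℚᵘ (+ n) 0
      ≈⟨ ℚᵘ.*≡* (trans (ℤ.*-identityʳ (i * + n)) (cong (λ t → i * + t) (sym (*-identityʳ n)))) ⟩
    ℚᵘ.mkℚᵘ i 0
      ≈⟨ ℚ.toℚᵘ-fromℚᵘ (ℚᵘ.mkℚᵘ i 0) ⟨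
    toℚᵘ (ℤtoℚ i)
      ∎)
    where open ℚᵘ.≃-Reasoning

  divPow-*-^ : ∀ v p s .{{_ : NonZero p}} → divPow v p s ℚ.* ℕtoℚ (p ^ s) ≡ ℤtoℚ v
  divPow-*-^ v p@(suc _) s = /-*-cancel v (p ^ s) {{m^n≢0 p s}}

  ℚ-ring : AlmostCommutativeRing 0ℓ 0ℓ
  ℚ-ring = fromCommutativeRing ℚ.+-*-commutativeRing (λ x → dec⇒maybe (0ℚ ℚ.≟ x))

  expansion-relation-scaled : ∀ X V Y Q → ((V ℚ.- X) ℚ.- Y) ℚ.- X ℚ.* V ℚ.* Y ≡ 0ℚ →
    V ℚ.* Q ≡ Q ℚ.* (X ℚ.+ Y) ℚ.+ X ℚ.* (V ℚ.* Q) ℚ.* Y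
  expansion-relation-scaled X V Y Q rel = begin
    V ℚ.* Q                  ≡⟨ identity X V Y Q ⟩
    R ℚ.+ E ℚ.* Q            ≡⟨ cong (λ t → R ℚ.+ t ℚ.* Q) rel ⟩
    R ℚ.+ 0ℚ ℚ.* Q           ≡⟨ cong (R ℚ.+_) (ℚ.*-zeroˡ Q) ⟩
    R ℚ.+ 0ℚ                 ≡⟨ ℚ.+-identityʳ R ⟩
    R                        ∎
    where
    open ≡-Reasoning
    R = Q ℚ.* (X ℚ.+ Y) ℚ.+ X ℚ.* (V ℚ.* Q) ℚ.* Y
    E = ((V ℚ.- X) ℚ.- Y) ℚ.- X ℚ.* V ℚ.* Y
    identity : ∀ X V Y Q → V ℚ.* Q ≡ (Q ℚ.* (X ℚ.+ Y) ℚ.+ X ℚ.* (V ℚ.* Q) ℚ.* Y)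
                                     ℚ.+ (((V ℚ.- X) ℚ.- Y) ℚ.- X ℚ.* V ℚ.* Y) ℚ.* Q
    identity = solve-∀ ℚ-ring

  v≡q[x+y]+xvy⇒v[1-xy]≡q[x+y] : ∀ {x y v q} →
    v ≡ q * (x + y) + x * v * y → v * (1ℤ - x * y) ≡ q * (x + y)
  v≡q[x+y]+xvy⇒v[1-xy]≡q[x+y] {x} {y} {v} {q} v≡ = begin
    v * (1ℤ - x * y)                        ≡⟨ solve (x ∷ y ∷ v ∷ []) ⟩
    v - x * v * y                           ≡⟨ cong (_- x * v * y) v≡ ⟩
    (q * (x + y) + x * v * y) - x * v * y   ≡⟨ solve (x ∷ y ∷ v ∷ q ∷ []) ⟩
    q * (x + y)                             ∎
    where open ≡-Reasoning

  expansion-relation-ℤ : ∀ x y v p s .{{_ : NonZero p}} →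
    let X = ℤtoℚ x ; Y = ℤtoℚ y ; V = divPow v p s in
    ((V ℚ.- X) ℚ.- Y) ℚ.- X ℚ.* V ℚ.* Y ≡ 0ℚ →
    v * (1ℤ - x * y) ≡ + (p ^ s) * (x + y)
  expansion-relation-ℤ x y v p s rel = v≡q[x+y]+xvy⇒v[1-xy]≡q[x+y] {x} {y} {v} {q} v≡q[x+y]+xvy
    where
    open ≡-Reasoning
    q = + (p ^ s)
    X = ℤtoℚ x
    Y = ℤtoℚ y
    Q = ℕtoℚ (p ^ s)
    scaled : ℤtoℚ v ≡ Q ℚ.* (X ℚ.+ Y) ℚ.+ X ℚ.* ℤtoℚ v ℚ.* Y
    scaled = subst (λ t → t ≡ Q ℚ.* (X ℚ.+ Y) ℚ.+ X ℚ.* t ℚ.* Y) (divPow-*-^ v p s)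
                   (expansion-relation-scaled X (divPow v p s) Y Q rel)
    v≡q[x+y]+xvy : v ≡ q * (x + y) + x * v * y
    v≡q[x+y]+xvy = ℤtoℚ-injective (begin
      ℤtoℚ v
        ≡⟨ scaled ⟩
      Q ℚ.* (X ℚ.+ Y) ℚ.+ X ℚ.* ℤtoℚ v ℚ.* Y
        ≡⟨ cong₂ (λ s t → Q ℚ.* s ℚ.+ t ℚ.* Y) (ℤtoℚ-homo-+ x y) (ℤtoℚ-homo-* x v) ⟨
      Q ℚ.* ℤtoℚ (x + y) ℚ.+ ℤtoℚ (x * v) ℚ.* Y
        ≡⟨ cong₂ ℚ._+_ (ℤtoℚ-homo-* q (x + y)) (ℤtoℚ-homo-* (x * v) y) ⟨
      ℤtoℚ (q * (x + y)) ℚ.+ ℤtoℚ (x * v * y)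
        ≡⟨ ℤtoℚ-homo-+ (q * (x + y)) (x * v * y) ⟨
      ℤtoℚ (q * (x + y) + x * v * y)
        ∎)

open IntegersInRationals using (expansion-relation-ℤ)

module NaturalBounds where

  open import Data.Nat
  open import Data.Nat.Properties
  open import Data.Nat.Divisibility
  open import Data.Nat.GCD using (gcd; gcd-greatest; c*gcd[m,n]≡gcd[cm,cn])
  open import Data.Nat.Primality using (Prime; euclidsLemma; prime⇒nonZero)
  open import Data.Nat.Tactic.RingSolver using (solve)
  open import Data.List using ([]; _∷_)
  open import Data.Product using (_×_; _,_)
  open import Data.Sum using (inj₁; inj₂)
  open import Relation.Nullary using (¬_; yes; no; contradiction)
  open import Relation.Binary.PropositionalEquality

  ∣*-gcd : ∀ n {m o r} → m ∣ n * o → m ∣ n * r → m ∣ n * gcd o r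
  ∣*-gcd n {o = o} {r} m∣no m∣nr =
    subst (_ ∣_) (sym (c*gcd[m,n]≡gcd[cm,cn] n o r)) (gcd-greatest m∣no m∣nr)

  prime^∣*⇒∣ : ∀ {p m n} → Prime p → ¬ p ∣ m → ∀ s → p ^ s ∣ m * n → p ^ s ∣ n
  prime^∣*⇒∣ pr p∤m zero    _ = 1∣ _
  prime^∣*⇒∣ {p} {m} {n} pr p∤m (suc s) p^[1+s]∣mn
    with euclidsLemma m n pr (∣-trans (m∣m*n (p ^ s)) p^[1+s]∣mn)
  ... | inj₁ p∣m = contradiction p∣m p∤m
  ... | inj₂ (divides o refl) =
    subst (_∣ o * p) (*-comm (p ^ s) p) (*-monoˡ-∣ p (prime^∣*⇒∣ pr p∤m s p^s∣mo))
    where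
    instance _ = prime⇒nonZero pr
    p^s∣mo : p ^ s ∣ m * o
    p^s∣mo = *-cancelʳ-∣ p (subst₂ _∣_ (*-comm p (p ^ s)) (sym (*-assoc m o p)) p^[1+s]∣mn)

  q∣a∧ab∣qk⇒q≤k+2 : ∀ {q a b k} .{{_ : NonZero a}} .{{_ : NonZero (q * k)}} →
    q ∣ a → a * b ∣ q * k → a ≤ b + 2 → q ≤ k + 2
  q∣a∧ab∣qk⇒q≤k+2 {q} {a} {b} {k} q∣a ab∣qk a≤b+2 = begin
    q      ≤⟨ q≤a ⟩
    a      ≤⟨ a≤b+2 ⟩
    b + 2  ≤⟨ +-monoˡ-≤ 2 b≤k ⟩
    k + 2  ∎
    where
    open ≤-Reasoning
    q≤a : q ≤ a
    q≤a = ∣⇒≤ q∣a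
    b≤k : b ≤ k
    b≤k = *-cancelˡ-≤ a (begin
      a * b  ≤⟨ ∣⇒≤ ab∣qk ⟩
      q * k  ≤⟨ *-monoˡ-≤ k q≤a ⟩
      a * k  ∎)

  p^s∣ab∧ab∣p^sk⇒p^s≤k+2 : ∀ {p a b k} s → Prime p → ¬ (p ∣ a × p ∣ b) →
    .{{_ : NonZero (a * b)}} .{{_ : NonZero (p ^ s * k)}} →
    p ^ s ∣ a * b → a * b ∣ p ^ s * k → a ≤ b + 2 → b ≤ a + 2 → p ^ s ≤ k + 2
  p^s∣ab∧ab∣p^sk⇒p^s≤k+2 {p} {a} {b} {k} s pr p∤a∧b p^s∣ab ab∣p^sk a≤b+2 b≤a+2
    with p ∣? b
  ... | no p∤b = q∣a∧ab∣qk⇒q≤k+2 {{m*n≢0⇒m≢0 a}}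
    (prime^∣*⇒∣ pr p∤b s (subst (p ^ s ∣_) (*-comm a b) p^s∣ab))
    ab∣p^sk a≤b+2
  ... | yes p∣b = q∣a∧ab∣qk⇒q≤k+2 {{m*n≢0⇒n≢0 a}}
    (prime^∣*⇒∣ pr (λ p∣a → p∤a∧b (p∣a , p∣b)) s p^s∣ab)
    (subst (_∣ p ^ s * k) (*-comm a b) ab∣p^sk) b≤a+2

  qU≤k[cE] : ∀ {q U T V E c k} .{{_ : NonZero U}} →
    V * T ≡ q * U → U * E ≡ c * T → V ≤ c → U ≤ V * k → q * U ≤ k * (c * E)
  qU≤k[cE] {q} {U} {T} {V} {E} {c} {k} VT≡qU UE≡cT V≤c U≤Vk = *-cancelʳ-≤ _ _ U (begin
    q * U * U        ≡⟨ cong (_* U) VT≡qU ⟨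
    V * T * U        ≤⟨ *-monoʳ-≤ (V * T) U≤Vk ⟩
    V * T * (V * k)  ≡⟨ solve (V ∷ T ∷ k ∷ []) ⟩
    V * V * (k * T)  ≤⟨ *-monoˡ-≤ (k * T) (*-mono-≤ V≤c V≤c) ⟩
    c * c * (k * T)  ≡⟨ solve (c ∷ k ∷ T ∷ []) ⟩
    k * c * (c * T)  ≡⟨ cong (k * c *_) UE≡cT ⟨
    k * c * (U * E)  ≡⟨ solve (k ∷ c ∷ U ∷ E ∷ []) ⟩
    k * (c * E) * U  ∎)
    where open ≤-Reasoning

  qU≤k[aU+bW]⇒[q∸ka]U≤kbW : ∀ {q U k a b W} →
    q * U ≤ k * (a * U + b * W) → (q ∸ k * a) * U ≤ k * b * W
  qU≤k[aU+bW]⇒[q∸ka]U≤kbW {q} {U} {k} {a} {b} {W} qU≤ = begin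
    (q ∸ k * a) * U      ≡⟨ *-distribʳ-∸ U q (k * a) ⟩
    q * U ∸ k * a * U    ≤⟨ m≤n+o⇒m∸n≤o (q * U) (k * a * U) (≤-trans qU≤ (≤-reflexive distrib)) ⟩
    k * b * W            ∎
    where
    open ≤-Reasoning
    distrib : k * (a * U + b * W) ≡ k * a * U + k * b * W
    distrib = solve (k ∷ a ∷ U ∷ b ∷ W ∷ [])

  ru≤mw⇒r²≤m²n : ∀ {r u m w n} .{{_ : NonZero u}} →
    r * u ≤ m * w → w * w ≤ n * (u * u) → r * r ≤ m * m * n
  ru≤mw⇒r²≤m²n {r} {u} {m} {w} {n} ru≤mw w²≤nu² =
    *-cancelʳ-≤ _ _ (u * u) {{m*n≢0 u u}} (begin
    r * r * (u * u)        ≡⟨ solve (r ∷ u ∷ []) ⟩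
    (r * u) * (r * u)      ≤⟨ *-mono-≤ ru≤mw ru≤mw ⟩
    (m * w) * (m * w)      ≡⟨ solve (m ∷ w ∷ []) ⟩
    m * m * (w * w)        ≤⟨ *-monoʳ-≤ (m * m) w²≤nu² ⟩
    m * m * (n * (u * u))  ≡⟨ solve (m ∷ n ∷ u ∷ []) ⟩
    m * m * n * (u * u)    ∎)
    where open ≤-Reasoning

  ≤+√-mono : ∀ {x k K a c} → k ≤ K → x ≤ k * a + k √ c → x ≤ K * a + K √ c
  ≤+√-mono {x} {k} {K} {a} {c} k≤K (inj₁ x≤ka) = inj₁ (≤-trans x≤ka (*-monoˡ-≤ a k≤K))
  ≤+√-mono {x} {k} {K} {a} {c} k≤K (inj₂ [x∸ka]²≤k²c) = inj₂ (begin
    (x ∸ K * a) * (x ∸ K * a)  ≤⟨ *-mono-≤ x∸Ka≤x∸ka x∸Ka≤x∸ka ⟩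
    (x ∸ k * a) * (x ∸ k * a)  ≤⟨ [x∸ka]²≤k²c ⟩
    k * k * c                  ≤⟨ *-monoˡ-≤ c (*-mono-≤ k≤K k≤K) ⟩
    K * K * c                  ∎)
    where
    open ≤-Reasoning
    x∸Ka≤x∸ka : x ∸ K * a ≤ x ∸ k * a
    x∸Ka≤x∸ka = ∸-monoʳ-≤ x (*-monoˡ-≤ a k≤K)

  ≤+⇒≤+√ : ∀ {x a b c} → x ≤ a + b → 1 ≤ c → x ≤ a + b √ c
  ≤+⇒≤+√ {x} {a} {b} {c} x≤a+b 1≤c = inj₂ (begin
    (x ∸ a) * (x ∸ a)  ≤⟨ *-mono-≤ x∸a≤b x∸a≤b ⟩
    b * b              ≡⟨ *-identityʳ (b * b) ⟨
    b * b * 1          ≤⟨ *-monoʳ-≤ (b * b) 1≤c ⟩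
    b * b * c          ∎)
    where
    open ≤-Reasoning
    x∸a≤b : x ∸ a ≤ b
    x∸a≤b = m≤n+o⇒m∸n≤o x a x≤a+b

open NaturalBounds

module IntegerBounds where

  open import Data.Nat as ℕ
    using (suc; NonZero; _^_; _∸_; z≤n; s≤s; ≢-nonZero; ≢-nonZero⁻¹; >-nonZero⁻¹; nonTrivial⇒n>1)
  open import Data.Nat.Properties as ℕ using (m^n≢0; m*n≢0; m+n≡0⇒n≡0)
  open import Data.Nat.Divisibility using (_∣_; divides; ∣⇒≤; n∣m*n; ∣-trans; _∣0)
  open import Data.Nat.GCD using (gcd; gcd[m,n]≢0)
  open import Data.Nat.Primality using (Prime; prime⇒nonZero; prime⇒nonTrivial)
  import Data.Nat.Tactic.RingSolver as ℕ-Solver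
  open import Data.Integer using (-[1+_]; _+_; _*_; _-_; -_; 1ℤ; 0ℤ; ∣_∣)
  open import Data.Integer.Properties as ℤ
    using (abs-*; ∣-i∣≡∣i∣; ∣i+j∣≤∣i∣+∣j∣; ∣i-j∣≤∣i∣+∣j∣; +◃n≡+n)
  import Data.Integer.Divisibility.Signed as Signed
  open import Data.Integer.Tactic.RingSolver using (solve; solve-∀)
  open import Data.List using ([]; _∷_)
  open import Data.Product using (_×_; _,_)
  open import Data.Sum using (inj₁; inj₂)
  open import Relation.Nullary using (contradiction)
  open import Relation.Binary.PropositionalEquality

  i*j≡k*l⇒∣i∣*∣j∣≡∣k∣*∣l∣ : ∀ i j k l → i * j ≡ k * l → ∣ i ∣ ℕ.* ∣ j ∣ ≡ ∣ k ∣ ℕ.* ∣ l ∣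
  i*j≡k*l⇒∣i∣*∣j∣≡∣k∣*∣l∣ i j k l eq = trans (sym (abs-* i j)) (trans (cong ∣_∣ eq) (abs-* k l))

  i*i≡+∣i∣*∣i∣ : ∀ i → i * i ≡ + (∣ i ∣ ℕ.* ∣ i ∣)
  i*i≡+∣i∣*∣i∣ (+ n)    = +◃n≡+n _
  i*i≡+∣i∣*∣i∣ -[1+ n ] = +◃n≡+n _

  p∤xyv⇒p∤v : ∀ {p} x y v → ¬ p ∣ ∣ x * y * v ∣ → ¬ p ∣ ∣ v ∣
  p∤xyv⇒p∤v x y v p∤xyv p∣v =
    p∤xyv (subst (_ ∣_) (sym (abs-* (x * y) v)) (∣-trans p∣v (n∣m*n ∣ x * y ∣)))

  p∤xyv⇒x≢0 : ∀ {p} x y v → ¬ p ∣ ∣ x * y * v ∣ → x ≢ 0ℤ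
  p∤xyv⇒x≢0 {p} .(+ 0) y v p∤xyv refl = p∤xyv (p ∣0)

  odd-prime∤x-1∧x+1 : ∀ {p} → Prime p → p ≢ 2 → ∀ x → ¬ ((p ∣ ∣ x - 1ℤ ∣) × (p ∣ ∣ x + 1ℤ ∣))
  odd-prime∤x-1∧x+1 {p} pr p≢2 x (p∣x-1 , p∣x+1) =
    p≢2 (ℕ.≤-antisym (∣⇒≤ p∣2) (nonTrivial⇒n>1 p {{prime⇒nonTrivial pr}}))
    where
    [x+1]-[x-1]≡2 : (x + 1ℤ) - (x - 1ℤ) ≡ + 2
    [x+1]-[x-1]≡2 = solve (x ∷ [])
    p∣2 : p ∣ 2
    p∣2 = Signed.∣⇒∣ᵤ (subst (Signed._∣_ (+ p)) [x+1]-[x-1]≡2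
      (Signed.∣m∣n⇒∣m-n (Signed.∣ᵤ⇒∣ {+ p} {x + 1ℤ} p∣x+1) (Signed.∣ᵤ⇒∣ {+ p} {x - 1ℤ} p∣x-1)))

  ∣x-1∣≤∣x+1∣+2 : ∀ x → ∣ x - 1ℤ ∣ ℕ.≤ ∣ x + 1ℤ ∣ ℕ.+ 2
  ∣x-1∣≤∣x+1∣+2 x =
    subst (λ t → ∣ t ∣ ℕ.≤ ∣ x + 1ℤ ∣ ℕ.+ 2) [x+1]-2≡x-1 (∣i-j∣≤∣i∣+∣j∣ (x + 1ℤ) (+ 2))
    where
    [x+1]-2≡x-1 : (x + 1ℤ) - + 2 ≡ x - 1ℤ
    [x+1]-2≡x-1 = solve (x ∷ [])

  ∣x+1∣≤∣x-1∣+2 : ∀ x → ∣ x + 1ℤ ∣ ℕ.≤ ∣ x - 1ℤ ∣ ℕ.+ 2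
  ∣x+1∣≤∣x-1∣+2 x =
    subst (λ t → ∣ t ∣ ℕ.≤ ∣ x - 1ℤ ∣ ℕ.+ 2) [x-1]+2≡x+1 (∣i+j∣≤∣i∣+∣j∣ (x - 1ℤ) (+ 2))
    where
    [x-1]+2≡x+1 : (x - 1ℤ) + + 2 ≡ x + 1ℤ
    [x-1]+2≡x+1 = solve (x ∷ [])

  ∣1-x*x∣≡∣x-1∣*∣x+1∣ : ∀ x → ∣ 1ℤ - x * x ∣ ≡ ∣ x - 1ℤ ∣ ℕ.* ∣ x + 1ℤ ∣
  ∣1-x*x∣≡∣x-1∣*∣x+1∣ x = begin
    ∣ 1ℤ - x * x ∣                    ≡⟨ cong ∣_∣ 1-x*x≡-[x-1][x+1] ⟩
    ∣ - ((x - 1ℤ) * (x + 1ℤ)) ∣       ≡⟨ ∣-i∣≡∣i∣ ((x - 1ℤ) * (x + 1ℤ)) ⟩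
    ∣ (x - 1ℤ) * (x + 1ℤ) ∣           ≡⟨ abs-* (x - 1ℤ) (x + 1ℤ) ⟩
    ∣ x - 1ℤ ∣ ℕ.* ∣ x + 1ℤ ∣         ∎
    where
    open ≡-Reasoning
    1-x*x≡-[x-1][x+1] : 1ℤ - x * x ≡ - ((x - 1ℤ) * (x + 1ℤ))
    1-x*x≡-[x-1][x+1] = solve (x ∷ [])

  v[x-1y]≡0⇒x≡y : ∀ x y v → ∣ v ∣ ≢ 0 → v * (x - + 1 * y) ≡ 0ℤ → x ≡ y
  v[x-1y]≡0⇒x≡y x y v V≢0 eq with ℤ.i*j≡0⇒i≡0∨j≡0 v eq
  ... | inj₁ v≡0   = contradiction (cong ∣_∣ v≡0) V≢0
  ... | inj₂ x-1y≡0 =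
    ℤ.i-j≡0⇒i≡j x y (trans (cong (λ t → x - t) (sym (ℤ.*-identityˡ y))) x-1y≡0)

  pell-factorisation : ∀ x y D → x * x - D * (y * y) ≡ D - 1ℤ →
    (x + y) * (x - D * y) ≡ (D - 1ℤ) * (1ℤ - x * y)
  pell-factorisation x y D pell = begin
    (x + y) * (x - D * y)                       ≡⟨ solve (x ∷ y ∷ D ∷ []) ⟩
    (x * x - D * (y * y)) - x * y * (D - 1ℤ)    ≡⟨ cong (_- x * y * (D - 1ℤ)) pell ⟩
    (D - 1ℤ) - x * y * (D - 1ℤ)                 ≡⟨ solve (x ∷ y ∷ D ∷ []) ⟩
    (D - 1ℤ) * (1ℤ - x * y)                     ∎
    where open ≡-Reasoning

  pell-sum-of-squares : ∀ x y D → x * x - D * (y * y) ≡ D - 1ℤ →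
    (x + D * y) * (x + D * y) + (D - 1ℤ) * (D - 1ℤ) ≡ D * ((x + y) * (x + y))
  pell-sum-of-squares x y D pell = begin
    (x + D * y) * (x + D * y) + (D - 1ℤ) * (D - 1ℤ)
      ≡⟨ cong (λ t → (x + D * y) * (x + D * y) + (D - 1ℤ) * t) pell ⟨
    (x + D * y) * (x + D * y) + (D - 1ℤ) * (x * x - D * (y * y))
      ≡⟨ solve (x ∷ y ∷ D ∷ []) ⟩
    D * ((x + y) * (x + y))                                       ∎
    where open ≡-Reasoning

  [D-1][x-Dy]≡2D[x+y]-[D+1][x+Dy] : ∀ x y D →
    (D - 1ℤ) * (x - D * y) ≡ (+ 2 * D) * (x + y) - (D + 1ℤ) * (x + D * y)
  [D-1][x-Dy]≡2D[x+y]-[D+1][x+Dy] = solve-∀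

  c∣x-Dy∣≤2d∣x+y∣+[d+1]∣x+Dy∣ : ∀ c x y → let d = suc c ; D = + d in
    c ℕ.* ∣ x - D * y ∣ ℕ.≤ 2 ℕ.* d ℕ.* ∣ x + y ∣ ℕ.+ (d ℕ.+ 1) ℕ.* ∣ x + D * y ∣
  c∣x-Dy∣≤2d∣x+y∣+[d+1]∣x+Dy∣ c x y = begin
    c ℕ.* ∣ x - D * y ∣
      ≡⟨ abs-* (D - 1ℤ) (x - D * y) ⟨
    ∣ (D - 1ℤ) * (x - D * y) ∣
      ≡⟨ cong ∣_∣ ([D-1][x-Dy]≡2D[x+y]-[D+1][x+Dy] x y D) ⟩
    ∣ (+ 2 * D) * (x + y) - (D + 1ℤ) * (x + D * y) ∣
      ≤⟨ ∣i-j∣≤∣i∣+∣j∣ ((+ 2 * D) * (x + y)) ((D + 1ℤ) * (x + D * y)) ⟩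
    ∣ (+ 2 * D) * (x + y) ∣ ℕ.+ ∣ (D + 1ℤ) * (x + D * y) ∣
      ≡⟨ cong₂ ℕ._+_ (trans (abs-* (+ 2 * D) (x + y)) (cong (ℕ._* ∣ x + y ∣) (abs-* (+ 2) D)))
                     (abs-* (D + 1ℤ) (x + D * y)) ⟩
    2 ℕ.* d ℕ.* ∣ x + y ∣ ℕ.+ (d ℕ.+ 1) ℕ.* ∣ x + D * y ∣
      ∎
    where
    open ℕ.≤-Reasoning
    d = suc c
    D = + d

  ∣x+Dy∣²+c²≡d∣x+y∣² : ∀ c x y → let d = suc c ; D = + d in
    x * x - D * (y * y) ≡ D - 1ℤ →
    ∣ x + D * y ∣ ℕ.* ∣ x + D * y ∣ ℕ.+ c ℕ.* c ≡ d ℕ.* (∣ x + y ∣ ℕ.* ∣ x + y ∣)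
  ∣x+Dy∣²+c²≡d∣x+y∣² c x y pell = begin
    ∣ + (∣ w ∣ ℕ.* ∣ w ∣) + + (c ℕ.* c) ∣  ≡⟨ cong₂ (λ s t → ∣ s + t ∣) (i*i≡+∣i∣*∣i∣ w)
                                                                        (i*i≡+∣i∣*∣i∣ (D - 1ℤ)) ⟨
    ∣ w * w + (D - 1ℤ) * (D - 1ℤ) ∣        ≡⟨ cong ∣_∣ (pell-sum-of-squares x y D pell) ⟩
    ∣ D * ((x + y) * (x + y)) ∣             ≡⟨ abs-* D ((x + y) * (x + y)) ⟩
    d ℕ.* ∣ (x + y) * (x + y) ∣             ≡⟨ cong (d ℕ.*_) (abs-* (x + y) (x + y)) ⟩
    d ℕ.* (∣ x + y ∣ ℕ.* ∣ x + y ∣)         ∎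
    where
    open ≡-Reasoning
    d = suc c
    D = + d
    w = x + D * y

  pell⇒∣x+y∣≢0 : ∀ c .{{_ : NonZero c}} x y → let D = + suc c in
    x * x - D * (y * y) ≡ D - 1ℤ → ∣ x + y ∣ ≢ 0
  pell⇒∣x+y∣≢0 c x y pell U≡0 = ≢-nonZero⁻¹ (c ℕ.* c) {{m*n≢0 c c}} (m+n≡0⇒n≡0 (W ℕ.* W) (begin
    W ℕ.* W ℕ.+ c ℕ.* c                        ≡⟨ ∣x+Dy∣²+c²≡d∣x+y∣² c x y pell ⟩
    suc c ℕ.* (∣ x + y ∣ ℕ.* ∣ x + y ∣)        ≡⟨ cong (λ t → suc c ℕ.* (t ℕ.* t)) U≡0 ⟩
    suc c ℕ.* 0                                ≡⟨ ℕ.*-zeroʳ (suc c) ⟩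
    0                                          ∎))
    where
    open ≡-Reasoning
    W = ∣ x + + suc c * y ∣

  bound-d≡1 : ∀ {p} s → Prime p → p ≢ 2 → (x y v : ℤ) → x ≡ y → x ≢ 0ℤ → ¬ p ∣ ∣ v ∣ →
    v * (1ℤ - x * y) ≡ + (p ^ s) * (x + y) →
    let k = gcd ∣ x + y ∣ ∣ 1ℤ - x * y ∣ in p ^ s ≤ k ℕ.* 2 + k √ 8
  bound-d≡1 {p} s pr p≢2 x .x v refl x≢0 p∤V rel = ≤+⇒≤+√ q≤k*2+k (s≤s z≤n)
    where
    open ℕ.≤-Reasoning
    q = p ^ s
    U = ∣ x + x ∣
    T = ∣ 1ℤ - x * x ∣
    V = ∣ v ∣
    k = gcd U T
    VT≡qU : V ℕ.* T ≡ q ℕ.* U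
    VT≡qU = i*j≡k*l⇒∣i∣*∣j∣≡∣k∣*∣l∣ v (1ℤ - x * x) (+ q) (x + x) rel
    2x≡x+x : + 2 * x ≡ x + x
    2x≡x+x = solve (x ∷ [])
    instance
      p≢0 : NonZero p
      p≢0 = prime⇒nonZero pr
      q≢0 : NonZero q
      q≢0 = m^n≢0 p s
      U≢0 : NonZero U
      U≢0 = ≢-nonZero λ U≡0 →
        x≢0 (ℤ.*-cancelˡ-≡ (+ 2) x 0ℤ (trans 2x≡x+x (ℤ.∣i∣≡0⇒i≡0 U≡0)))
      k≢0 : NonZero k
      k≢0 = ≢-nonZero (gcd[m,n]≢0 U T (inj₁ (≢-nonZero⁻¹ U)))
      qk≢0 : NonZero (q ℕ.* k)
      qk≢0 = m*n≢0 q k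
      T≢0 : NonZero T
      T≢0 = ≢-nonZero λ T≡0 → ≢-nonZero⁻¹ (q ℕ.* U) {{m*n≢0 q U}}
        (trans (sym VT≡qU) (trans (cong (V ℕ.*_) T≡0) (ℕ.*-zeroʳ V)))
    q∣T : q ∣ T
    q∣T = prime^∣*⇒∣ pr p∤V s (divides U (trans VT≡qU (ℕ.*-comm q U)))
    T∣qk : T ∣ q ℕ.* k
    T∣qk = ∣*-gcd q (divides V (sym VT≡qU)) (n∣m*n q)
    q≤k+2 : q ℕ.≤ k ℕ.+ 2
    q≤k+2 = p^s∣ab∧ab∣p^sk⇒p^s≤k+2 s pr (odd-prime∤x-1∧x+1 pr p≢2 x)
      {{subst NonZero T≡ab T≢0}} (subst (q ∣_) T≡ab q∣T) (subst (_∣ q ℕ.* k) T≡ab T∣qk)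
      (∣x-1∣≤∣x+1∣+2 x) (∣x+1∣≤∣x-1∣+2 x)
      where T≡ab = ∣1-x*x∣≡∣x-1∣*∣x+1∣ x
    q≤k*2+k : q ℕ.≤ k ℕ.* 2 ℕ.+ k
    q≤k*2+k = begin
      q              ≤⟨ q≤k+2 ⟩
      k ℕ.+ 2        ≡⟨ ℕ.+-comm k 2 ⟩
      2 ℕ.+ k        ≤⟨ ℕ.+-monoˡ-≤ k (ℕ.*-monoˡ-≤ 2 (>-nonZero⁻¹ k)) ⟩
      k ℕ.* 2 ℕ.+ k  ∎

  bound-d≥2 : ∀ c .{{_ : NonZero c}} q (x y v : ℤ) → ∣ v ∣ ≢ 0 → ∣ v ∣ ∣ c →
    let D = + suc c in
    x * x - D * (y * y) ≡ D - 1ℤ → v * (1ℤ - x * y) ≡ + q * (x + y) →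
    let d = suc c ; k = gcd ∣ x + y ∣ ∣ 1ℤ - x * y ∣ in
    q ≤ k ℕ.* (2 ℕ.* d) + k √ ((d ℕ.+ 1) ^ 3)
  bound-d≥2 c q x y v V≢0 V∣c pell rel =
    inj₂ (ℕ.≤-trans
      (ru≤mw⇒r²≤m²n {q ∸ k ℕ.* (2 ℕ.* d)} {U} {k ℕ.* (d ℕ.+ 1)} {W} {d ℕ.+ 1} rU≤k[d+1]W W²≤[d+1]U²)
      (ℕ.≤-reflexive ([ke]²e≡k²e³ k (d ℕ.+ 1))))
    where
    open ℕ.≤-Reasoning
    d = suc c
    D = + d
    U = ∣ x + y ∣
    T = ∣ 1ℤ - x * y ∣
    V = ∣ v ∣
    E = ∣ x - D * y ∣
    W = ∣ x + D * y ∣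
    k = gcd U T
    VT≡qU : V ℕ.* T ≡ q ℕ.* U
    VT≡qU = i*j≡k*l⇒∣i∣*∣j∣≡∣k∣*∣l∣ v (1ℤ - x * y) (+ q) (x + y) rel
    UE≡cT : U ℕ.* E ≡ c ℕ.* T
    UE≡cT = i*j≡k*l⇒∣i∣*∣j∣≡∣k∣*∣l∣ (x + y) (x - D * y) (D - 1ℤ) (1ℤ - x * y)
              (pell-factorisation x y D pell)
    W²+c²≡dU² : W ℕ.* W ℕ.+ c ℕ.* c ≡ d ℕ.* (U ℕ.* U)
    W²+c²≡dU² = ∣x+Dy∣²+c²≡d∣x+y∣² c x y pell
    instance
      U≢0 : NonZero U
      U≢0 = ≢-nonZero (pell⇒∣x+y∣≢0 c x y pell)
      k≢0 : NonZero k
      k≢0 = ≢-nonZero (gcd[m,n]≢0 U T (inj₁ (≢-nonZero⁻¹ U)))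
      V≢0ᴵ : NonZero V
      V≢0ᴵ = ≢-nonZero V≢0
      Vk≢0 : NonZero (V ℕ.* k)
      Vk≢0 = m*n≢0 V k
    U≤Vk : U ℕ.≤ V ℕ.* k
    U≤Vk = ∣⇒≤ (∣*-gcd V (n∣m*n V) (divides q VT≡qU))
    rU≤k[d+1]W : (q ∸ k ℕ.* (2 ℕ.* d)) ℕ.* U ℕ.≤ k ℕ.* (d ℕ.+ 1) ℕ.* W
    rU≤k[d+1]W = qU≤k[aU+bW]⇒[q∸ka]U≤kbW {q} {U} {k} {2 ℕ.* d} {d ℕ.+ 1} {W} (begin
      q ℕ.* U
        ≤⟨ qU≤k[cE] {q} {U} {T} {V} {E} {c} {k} VT≡qU UE≡cT (∣⇒≤ V∣c) U≤Vk ⟩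
      k ℕ.* (c ℕ.* E)
        ≤⟨ ℕ.*-monoʳ-≤ k (c∣x-Dy∣≤2d∣x+y∣+[d+1]∣x+Dy∣ c x y) ⟩
      k ℕ.* (2 ℕ.* d ℕ.* U ℕ.+ (d ℕ.+ 1) ℕ.* W)
        ∎)
    W²≤[d+1]U² : W ℕ.* W ℕ.≤ (d ℕ.+ 1) ℕ.* (U ℕ.* U)
    W²≤[d+1]U² = begin
      W ℕ.* W                  ≤⟨ ℕ.m≤m+n (W ℕ.* W) (c ℕ.* c) ⟩
      W ℕ.* W ℕ.+ c ℕ.* c      ≡⟨ W²+c²≡dU² ⟩
      d ℕ.* (U ℕ.* U)          ≤⟨ ℕ.*-monoˡ-≤ (U ℕ.* U) (ℕ.m≤m+n d 1) ⟩
      (d ℕ.+ 1) ℕ.* (U ℕ.* U)  ∎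
    [ke]²e≡k²e³ : ∀ k e → k ℕ.* e ℕ.* (k ℕ.* e) ℕ.* e ≡ k ℕ.* k ℕ.* (e ℕ.* (e ℕ.* (e ℕ.* 1)))
    [ke]²e≡k²e³ = ℕ-Solver.solve-∀

open IntegerBounds using (p∤xyv⇒p∤v; p∤xyv⇒x≢0; v[x-1y]≡0⇒x≡y; bound-d≡1; bound-d≥2)

proposition4p21 : (d : ℕ) → d ≥ 1 → SquareFree d →
    (p : ℕ) → Prime p → p ≢ 2 →
    (a₁ a₃ v : ℤ) (s : ℕ) → s ≥ 1 →
    ¬ ((+ p) ∣ℤ (a₁ ℤ.* a₃ ℤ.* v)) →
    v ∣ℤ ((+ d) ℤ.- ℤ.1ℤ) →
    (a₁ ℤ.* a₁) ℤ.- ((+ d) ℤ.* (a₃ ℤ.* a₃)) ≡ (+ d) ℤ.- ℤ.1ℤ →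
    v ℤ.* (a₁ ℤ.- ((+ d) ℤ.* a₃)) ≡ ((+ d) ℤ.- ℤ.1ℤ) ℤ.* (+ (p ℕ.^ s)) →
    IsExpansion03 p d (ℤtoℚ a₁) (divPow v p s) (ℤtoℚ a₃) →
    let k = ℤ.∣ gcdℤ (a₁ ℤ.+ a₃) (ℤ.1ℤ ℤ.- (a₁ ℤ.* a₃)) ∣
        K = k ℕ.* (p ℕ.^ (2 ℕ.* vℕ p (d ℕ.+ 1)))
    in p ℕ.^ s ≤ K ℕ.* (2 ℕ.* d) + K √ ((d ℕ.+ 1) ℕ.^ 3)
proposition4p21 d d≥1 _ p pr p≢2 a₁ a₃ v s _ p∤a₁a₃v v∣d-1 pell norm (_ , _ , _ , rel , _) =
  ≤+√-mono (m≤m*n k (p ℕ.^ e) {{m^n≢0 p e}}) (bound d d≥1 v∣d-1 pell norm)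
  where
  instance _ = prime⇒nonZero pr
  e = 2 ℕ.* vℕ p (d ℕ.+ 1)
  k = ℤ.∣ gcdℤ (a₁ ℤ.+ a₃) (ℤ.1ℤ ℤ.- (a₁ ℤ.* a₃)) ∣
  p∤V = p∤xyv⇒p∤v a₁ a₃ v p∤a₁a₃v
  V≢0 : ℤ.∣ v ∣ ≢ 0
  V≢0 V≡0 = p∤V (subst (p ∣_) (sym V≡0) (p ∣0))
  v[1-a₁a₃]≡q[a₁+a₃] = expansion-relation-ℤ a₁ a₃ v p s rel
  bound : ∀ d → d ≥ 1 → v ∣ℤ ((+ d) ℤ.- ℤ.1ℤ) →
    (a₁ ℤ.* a₁) ℤ.- ((+ d) ℤ.* (a₃ ℤ.* a₃)) ≡ (+ d) ℤ.- ℤ.1ℤ →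
    v ℤ.* (a₁ ℤ.- ((+ d) ℤ.* a₃)) ≡ ((+ d) ℤ.- ℤ.1ℤ) ℤ.* (+ (p ℕ.^ s)) →
    p ℕ.^ s ≤ k ℕ.* (2 ℕ.* d) + k √ ((d ℕ.+ 1) ℕ.^ 3)
  bound zero ()
  bound (suc zero) _ _ _ norm =
    bound-d≡1 s pr p≢2 a₁ a₃ v (v[x-1y]≡0⇒x≡y a₁ a₃ v V≢0 norm) (p∤xyv⇒x≢0 a₁ a₃ v p∤a₁a₃v) p∤V
      v[1-a₁a₃]≡q[a₁+a₃]
  bound (suc (suc c)) _ v∣d-1 pell _ =
    bound-d≥2 (suc c) (p ℕ.^ s) a₁ a₃ v V≢0 v∣d-1 pell v[1-a₁a₃]≡q[a₁+a₃]
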